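{- Let $n\ge 1$ and let ${\cal ORCT}_n$ be the set of full contractions of $X_n=\{1,\dots,n\}$ that are order-preserving or order-reversing. For $1\le k\le n$, the number of $\alpha\in{\cal ORCT}_n$ with $w^+(\alpha)=k$ is $2\sum_{p=1}^{k}\binom{n-1}{p-1}-1$.
   Context: Full transformations are maps $\alpha:X_n\to X_n$, written $x\mapsto x\alpha$. Order-preserving: $x\le y\Rightarrow x\alpha\le y\alpha$; order-reversing: $x\le y\Rightarrow x\alpha\ge y\alpha$. Contraction: $|x\alpha-y\alpha|\le|x-y|$ for all $x,y$. $w^+(\alpha)=\max(\mathrm{Im}\,\alpha)$. -}

module Defs where

open import Data.Nat.Base using (ℕ; zero; suc; _+_; _≤_; _≥_; ∣_-_∣)
open import Data.Nat.Properties using (_≤?_; _≟_)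
open import Data.Fin.Base using (Fin; toℕ)
import Data.Fin.Base as F
open import Data.Fin.Properties using (all?; any?)
open import Data.List.Base using (List; []; _∷_; concatMap; map; length; filter; allFin)
open import Data.Product using (_×_; ∃; _,_)
open import Data.Sum using (_⊎_)
open import Relation.Binary.PropositionalEquality using (_≡_)
open import Relation.Nullary using (Dec; yes; no)
open import Relation.Nullary.Decidable using (_×-dec_; _⊎-dec_; _→-dec_)

-- X_n = {1,…,n} is represented by Fin n; element i : Fin n stands for toℕ i + 1.
-- A full transformation of X_n is a function Fin n → Fin n.
Transformation : ℕ → Set
Transformation n = Fin n → Fin n

OrderPreserving : ∀ {n} → Transformation n → Set
OrderPreserving {n} α = ∀ (x y : Fin n) → toℕ x ≤ toℕ y → toℕ (α x) ≤ toℕ (α y)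

OrderReversing : ∀ {n} → Transformation n → Set
OrderReversing {n} α = ∀ (x y : Fin n) → toℕ x ≤ toℕ y → toℕ (α x) ≥ toℕ (α y)

Contraction : ∀ {n} → Transformation n → Set
Contraction {n} α = ∀ (x y : Fin n) → ∣ toℕ (α x) - toℕ (α y) ∣ ≤ ∣ toℕ x - toℕ y ∣

IsORCT : ∀ {n} → Transformation n → Set
IsORCT α = Contraction α × (OrderPreserving α ⊎ OrderReversing α)

-- w⁺(α) = k, i.e. k = max (Im α) in the 1-based labelling of X_n:
-- k is attained as an image value and every image value is ≤ k.
WPlusIs : ∀ {n} → Transformation n → ℕ → Set
WPlusIs {n} α k = (∃ λ (x : Fin n) → toℕ (α x) + 1 ≡ k) × (∀ (x : Fin n) → toℕ (α x) + 1 ≤ k)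

private
  dec→ : ∀ {n} (α : Transformation n) (R : ℕ → ℕ → Set) → (∀ a b → Dec (R a b)) →
         Dec (∀ (x y : Fin n) → toℕ x ≤ toℕ y → R (toℕ (α x)) (toℕ (α y)))
  dec→ α R R? = all? λ x → all? λ y → (toℕ x ≤? toℕ y) →-dec R? (toℕ (α x)) (toℕ (α y))

isORCT? : ∀ {n} (α : Transformation n) → Dec (IsORCT α)
isORCT? α = (all? λ x → all? λ y → ∣ toℕ (α x) - toℕ (α y) ∣ ≤? ∣ toℕ x - toℕ y ∣)
            ×-dec (dec→ α _≤_ _≤?_ ⊎-dec dec→ α (λ a b → b ≤ a) (λ a b → b ≤? a))

wPlusIs? : ∀ {n} (α : Transformation n) (k : ℕ) → Dec (WPlusIs α k)
wPlusIs? α k = (any? λ x → toℕ (α x) + 1 ≟ k) ×-dec (all? λ x → toℕ (α x) + 1 ≤? k)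

allFunctions : ∀ {B : Set} → List B → (m : ℕ) → List (Fin m → B)
allFunctions bs zero    = (λ ()) ∷ []
allFunctions bs (suc m) = concatMap (λ b → map (cons b) (allFunctions bs m)) bs
  where
    cons : _ → (Fin m → _) → Fin (suc m) → _
    cons b f F.zero    = b
    cons b f (F.suc i) = f i

allTransformations : (n : ℕ) → List (Transformation n)
allTransformations n = allFunctions (allFin n) n

countORCTw : (n k : ℕ) → ℕ
countORCTw n k = length (filter (λ α → isORCT? α ×-dec wPlusIs? α k) (allTransformations n))

sumFrom1 : ℕ → (ℕ → ℕ) → ℕ
sumFrom1 zero    f = 0
sumFrom1 (suc k) f = sumFrom1 k f + f (suc k)

module Submission where

-- Write OPC / ORC for the order-preserving / order-reversing contractions.  An
-- OPC sequence g₀,…,g_M climbs by steps 0 or 1, an ORC sequence descends by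
-- steps 0 or 1, and a map in both classes is constant.  By inclusion–exclusion
--   #ORCT(max t) = #OPC(max t) + #ORC(max t) − #constant(max t).
-- Each count is computed by peeling off the first value of the sequence: the
-- enumeration of all maps Fin (M+1) → Fin n used in the statement is a
-- concatenation over the first value b, and prepending b to a sequence f
-- preserves OPC (resp. ORC) exactly when f₀ ∈ {b, b+1} (resp. b ∈ {f₀, f₀+1}).
-- This yields Pascal-type recurrences in the length of the sequence:
--   * ORC sequences of length M+1 starting (hence peaking) at t: Σ_{j≤t} C(M,j);
--   * OPC sequences starting at a with maximum t: C(M, t−a), and summing over
--     the starting value a ≤ t again gives Σ_{j≤t} C(M,j);
--   * constant sequences with value t: exactly one.
-- Hence the count is 2·Σ_{j≤t} C(M,j) − 1, which is the theorem with n = M+1.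

open import Defs
open import Data.Nat.Base using (ℕ; zero; suc; _+_; _*_; _∸_; _≤_; _<_; z≤n; s≤s; ∣_-_∣)
open import Data.Nat.Combinatorics using (_C_; nCk+nC[k+1]≡[n+1]C[k+1]; k>n⇒nCk≡0)
open import Data.Nat.Properties
open import Level using (0ℓ)
open import Data.Fin.Base using (Fin; toℕ; zero; suc)
open import Data.Fin.Properties using (all?; any?; toℕ-injective; toℕ<n)
open import Data.Vec.Functional using () renaming (_∷_ to _◂_)
open import Data.List.Base using (List; []; _∷_; _++_; map; concatMap; filter; length; tabulate; allFin)
open import Data.List.Properties using (filter-≐; filter-none; filter-accept; filter-++; length-++)
import Data.List.Relation.Unary.All as All
open import Data.Product using (_×_; _,_; proj₁; proj₂; ∃)
open import Data.Sum using (_⊎_; inj₁; inj₂)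
open import Data.Unit using (tt)
open import Function.Bundles using (_⇔_; mk⇔; Equivalence)
open import Relation.Nullary using (Dec; yes; no; ¬_)
open import Relation.Nullary.Decidable using (_×-dec_; _→-dec_)
open import Relation.Unary using (Pred; Decidable; Empty; _≐_; _∪_; _∩_)
open import Relation.Unary.Properties using (U?; _∪?_; _∩?_)
open import Relation.Binary.PropositionalEquality
  using (_≡_; refl; sym; trans; cong; cong₂; subst; subst₂; _≗_; module ≡-Reasoning)
open import Algebra.Properties.Monoid.Sum +-0-monoid using (sum-syntax; sum-cong-≗)

open Equivalence using (to; from)

private
  variable
    A B : Set

count : {P : Pred A 0ℓ} → Decidable P → List A → ℕ
count P? xs = length (filter P? xs)

count-≐ : {P Q : Pred A 0ℓ} (P? : Decidable P) (Q? : Decidable Q) →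
          P ≐ Q → ∀ xs → count P? xs ≡ count Q? xs
count-≐ P? Q? P≐Q xs = cong length (filter-≐ P? Q? P≐Q xs)

count-∅ : {P : Pred A 0ℓ} (P? : Decidable P) → Empty P → ∀ xs → count P? xs ≡ 0
count-∅ P? ∄P xs = cong length (filter-none P? (All.universal ∄P xs))

count-++ : {P : Pred A 0ℓ} (P? : Decidable P) →
           ∀ xs ys → count P? (xs ++ ys) ≡ count P? xs + count P? ys
count-++ P? xs ys = trans (cong length (filter-++ P? xs ys)) (length-++ (filter P? xs))

count-∪ : {P Q : Pred A 0ℓ} (P? : Decidable P) (Q? : Decidable Q) →
          ∀ xs → count (P? ∪? Q?) xs + count (P? ∩? Q?) xs ≡ count P? xs + count Q? xs
count-∪ P? Q? [] = refl
count-∪ P? Q? (x ∷ xs) with P? x | Q? x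
... | yes _ | yes _ = cong suc (trans (+-suc _ _) (trans (cong suc (count-∪ P? Q? xs)) (sym (+-suc _ _))))
... | yes _ | no _  = cong suc (count-∪ P? Q? xs)
... | no _  | yes _ = trans (cong suc (count-∪ P? Q? xs)) (sym (+-suc _ _))
... | no _  | no _  = count-∪ P? Q? xs

count-disjoint-∪ : {P Q : Pred A 0ℓ} (P? : Decidable P) (Q? : Decidable Q) →
                   Empty (P ∩ Q) → ∀ xs → count (P? ∪? Q?) xs ≡ count P? xs + count Q? xs
count-disjoint-∪ P? Q? disjoint xs = begin
  count (P? ∪? Q?) xs                           ≡⟨ sym (+-identityʳ _) ⟩
  count (P? ∪? Q?) xs + 0                       ≡⟨ cong (count (P? ∪? Q?) xs +_) (sym (count-∅ (P? ∩? Q?) disjoint xs)) ⟩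
  count (P? ∪? Q?) xs + count (P? ∩? Q?) xs     ≡⟨ count-∪ P? Q? xs ⟩
  count P? xs + count Q? xs                     ∎
  where open ≡-Reasoning

count-map : {P : Pred A 0ℓ} (P? : Decidable P) (h : B → A) →
            ∀ xs → count P? (map h xs) ≡ count (λ x → P? (h x)) xs
count-map P? h [] = refl
count-map P? h (x ∷ xs) with P? (h x)
... | yes _ = cong suc (count-map P? h xs)
... | no _  = count-map P? h xs

count-concat : {P : Pred A 0ℓ} (P? : Decidable P) (G : B → List A) →
               ∀ k (f : Fin k → B) → count P? (concatMap G (tabulate f)) ≡ ∑[ i < k ] count P? (G (f i))
count-concat P? G zero f = refl
count-concat P? G (suc k) f =
  trans (count-++ P? (G (f zero)) _) (cong (_ +_) (count-concat P? G k (λ i → f (suc i))))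

∑-zero : ∀ {k} (F : Fin k → ℕ) → (∀ i → F i ≡ 0) → ∑[ i < k ] F i ≡ 0
∑-zero {zero}  F F≡0 = refl
∑-zero {suc k} F F≡0 = cong₂ _+_ (F≡0 zero) (∑-zero (λ i → F (suc i)) (λ i → F≡0 (suc i)))

∑-single : ∀ {k} (F : Fin k → ℕ) a → a < k → (∀ i → ¬ toℕ i ≡ a → F i ≡ 0) →
           ∀ X → (∀ i → toℕ i ≡ a → F i ≡ X) → ∑[ i < k ] F i ≡ X
∑-single {suc k} F zero    _         off X on =
  trans (cong₂ _+_ (on zero refl) (∑-zero _ (λ i → off (suc i) (λ ())))) (+-identityʳ X)
∑-single {suc k} F (suc a) (s≤s a<k) off X on =
  trans (cong (_+ ∑[ i < k ] F (suc i)) (off zero (λ ())))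
        (∑-single (λ i → F (suc i)) a a<k (λ i i≢a → off (suc i) (λ e → i≢a (suc-injective e)))
                  X (λ i e → on (suc i) (cong suc e)))

∑-truncate : ∀ {k n} (F : ℕ → ℕ) → k ≤ n → (∀ a → k ≤ a → F a ≡ 0) →
             ∑[ i < n ] F (toℕ i) ≡ ∑[ i < k ] F (toℕ i)
∑-truncate {zero}  {n}    F _         vanish = ∑-zero {n} _ (λ i → vanish (toℕ i) z≤n)
∑-truncate {suc k} {suc n} F (s≤s k≤n) vanish =
  cong (F 0 +_) (∑-truncate (λ a → F (suc a)) k≤n (λ a k≤a → vanish (suc a) (s≤s k≤a)))

-- binomSum m a = Σ_{j=0}^{a} C(m, j), written with the indexing of the theorem.
binomSum : ℕ → ℕ → ℕ
binomSum m a = sumFrom1 (suc a) (λ p → m C (p ∸ 1))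

binomSum-zero : ∀ a → binomSum 0 a ≡ 1
binomSum-zero zero    = refl
binomSum-zero (suc a) = trans (+-identityʳ (binomSum 0 a)) (binomSum-zero a)

binomSum-pascal : ∀ m a → binomSum (suc m) (suc a) ≡ binomSum m (suc a) + binomSum m a
binomSum-pascal m zero =
  trans (cong (1 +_) (sym (nCk+nC[k+1]≡[n+1]C[k+1] m 0))) (+-comm 1 (1 + m C 1))
binomSum-pascal m (suc a) = begin
  binomSum (suc m) (suc a) + suc m C suc (suc a)
    ≡⟨ cong₂ _+_ (binomSum-pascal m a) (sym (nCk+nC[k+1]≡[n+1]C[k+1] m (suc a))) ⟩
  (binomSum m (suc a) + binomSum m a) + (m C suc a + m C suc (suc a))
    ≡⟨ +-shuffle (binomSum m (suc a)) (binomSum m a) (m C suc a) (m C suc (suc a)) ⟩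
  (binomSum m (suc a) + m C suc (suc a)) + (binomSum m a + m C suc a) ∎
  where
    open ≡-Reasoning
    +-shuffle : ∀ w x y z → (w + x) + (y + z) ≡ (w + z) + (x + y)
    +-shuffle w x y z = solve 4 (λ w x y z → (w :+ x) :+ (y :+ z) := (w :+ z) :+ (x :+ y)) refl w x y z
      where open import Data.Nat.Solver using (module +-*-Solver)
            open +-*-Solver

binomSum-reversed : ∀ m t → ∑[ i < suc t ] (m C (t ∸ toℕ i)) ≡ binomSum m t
binomSum-reversed m zero    = +-identityʳ (m C 0)
binomSum-reversed m (suc t) =
  trans (cong (m C suc t +_) (binomSum-reversed m t)) (+-comm (m C suc t) (binomSum m t))

-- Within p q d: q lies above p by at most d.  Monotone contractions are the maps
-- whose values at x ≤ y are Within each other by the distance y − x.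

Within : ℕ → ℕ → ℕ → Set
Within p q d = p ≤ q × q ≤ d + p

within? : ∀ p q d → Dec (Within p q d)
within? p q d = (p ≤? q) ×-dec (q ≤? d + p)

within-refl : ∀ p → Within p p 0
within-refl p = ≤-refl , ≤-refl

within-trans : ∀ {p q r d e} → Within p q d → Within q r e → Within p r (e + d)
within-trans {p} {d = d} {e} (p≤q , q≤d+p) (q≤r , r≤e+q) =
  ≤-trans p≤q q≤r , ≤-trans r≤e+q (≤-trans (+-monoʳ-≤ e q≤d+p) (≤-reflexive (sym (+-assoc e d p))))

within-one : ∀ {p q} → Within p q 1 ⇔ (q ≡ p ⊎ q ≡ suc p)
within-one = mk⇔ step unstep
  where
    step : ∀ {p q} → Within p q 1 → q ≡ p ⊎ q ≡ suc p
    step (p≤q , q≤1+p) with m≤n⇒m<n∨m≡n q≤1+p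
    ... | inj₁ q<1+p = inj₁ (≤-antisym (≤-pred q<1+p) p≤q)
    ... | inj₂ q≡1+p = inj₂ q≡1+p
    unstep : ∀ {p q} → q ≡ p ⊎ q ≡ suc p → Within p q 1
    unstep (inj₁ refl) = ≤-refl , n≤1+n _
    unstep (inj₂ refl) = n≤1+n _ , ≤-refl

within⇒∣-∣≤ : ∀ {p q x y} → x ≤ y → Within p q (y ∸ x) → ∣ p - q ∣ ≤ ∣ x - y ∣
within⇒∣-∣≤ {p} {q} {x} {y} x≤y (p≤q , q≤) =
  subst₂ _≤_ (sym (m≤n⇒∣m-n∣≡n∸m p≤q)) (sym (m≤n⇒∣m-n∣≡n∸m x≤y))
         (≤-trans (∸-monoˡ-≤ p q≤) (≤-reflexive (m+n∸n≡m (y ∸ x) p)))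

∣-∣≤⇒within : ∀ {p q x y} → p ≤ q → x ≤ y → ∣ p - q ∣ ≤ ∣ x - y ∣ → Within p q (y ∸ x)
∣-∣≤⇒within {p} {q} {x} {y} p≤q x≤y close = p≤q , (begin
  q             ≡⟨ sym (m∸n+n≡m p≤q) ⟩
  q ∸ p + p     ≤⟨ +-monoˡ-≤ p (subst₂ _≤_ (m≤n⇒∣m-n∣≡n∸m p≤q) (m≤n⇒∣m-n∣≡n∸m x≤y) close) ⟩
  y ∸ x + p     ∎)
  where open ≤-Reasoning

∣-∣≤-swapˡ : ∀ p q {r} → ∣ p - q ∣ ≤ r → ∣ q - p ∣ ≤ r
∣-∣≤-swapˡ p q = subst (_≤ _) (∣-∣-comm p q)

-- Monotone contractions Fin m → Fin n, stated for ordered pairs x ≤ y.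
-- (For m = n these are exactly the contractions of Defs that preserve, resp.
-- reverse, the order; see opc⇔ and orc⇔ below.)

OPContraction : ∀ {m n} → Pred (Fin m → Fin n) 0ℓ
OPContraction g = ∀ x y → toℕ x ≤ toℕ y → Within (toℕ (g x)) (toℕ (g y)) (toℕ y ∸ toℕ x)

ORContraction : ∀ {m n} → Pred (Fin m → Fin n) 0ℓ
ORContraction g = ∀ x y → toℕ x ≤ toℕ y → Within (toℕ (g y)) (toℕ (g x)) (toℕ y ∸ toℕ x)

HeadIs : ∀ {m n} → ℕ → Pred (Fin (suc m) → Fin n) 0ℓ
HeadIs a g = toℕ (g zero) ≡ a

-- The largest image value is t (in the 0-based labelling of Fin n).
MaxIs : ∀ {m n} → ℕ → Pred (Fin m → Fin n) 0ℓ
MaxIs t g = (∃ λ x → toℕ (g x) ≡ t) × (∀ x → toℕ (g x) ≤ t)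

opc? : ∀ {m n} → Decidable (OPContraction {m} {n})
opc? g = all? λ x → all? λ y → (toℕ x ≤? toℕ y) →-dec within? (toℕ (g x)) (toℕ (g y)) (toℕ y ∸ toℕ x)

orc? : ∀ {m n} → Decidable (ORContraction {m} {n})
orc? g = all? λ x → all? λ y → (toℕ x ≤? toℕ y) →-dec within? (toℕ (g y)) (toℕ (g x)) (toℕ y ∸ toℕ x)

head? : ∀ {m n} a → Decidable (HeadIs {m} {n} a)
head? a g = toℕ (g zero) ≟ a

max? : ∀ {m n} t → Decidable (MaxIs {m} {n} t)
max? t g = (any? λ x → toℕ (g x) ≟ t) ×-dec (all? λ x → toℕ (g x) ≤? t)

contraction-from-ordered : ∀ {n} (α : Transformation n) →
  (∀ x y → toℕ x ≤ toℕ y → ∣ toℕ (α x) - toℕ (α y) ∣ ≤ ∣ toℕ x - toℕ y ∣) → Contraction α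
contraction-from-ordered α ordered x y with ≤-total (toℕ x) (toℕ y)
... | inj₁ x≤y = ordered x y x≤y
... | inj₂ y≤x = subst₂ _≤_ (∣-∣-comm (toℕ (α y)) (toℕ (α x))) (∣-∣-comm (toℕ y) (toℕ x)) (ordered y x y≤x)

opc⇔ : ∀ {n} {α : Transformation n} → OPContraction α ⇔ (Contraction α × OrderPreserving α)
opc⇔ {α = α} = mk⇔
  (λ opc → contraction-from-ordered α (λ x y x≤y → within⇒∣-∣≤ x≤y (opc x y x≤y)) ,
           λ x y x≤y → proj₁ (opc x y x≤y))
  (λ (c , op) x y x≤y → ∣-∣≤⇒within (op x y x≤y) x≤y (c x y))

orc⇔ : ∀ {n} {α : Transformation n} → ORContraction α ⇔ (Contraction α × OrderReversing α)
orc⇔ {α = α} = mk⇔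
  (λ orc → contraction-from-ordered α (λ x y x≤y → ∣-∣≤-swapˡ (toℕ (α y)) (toℕ (α x)) (within⇒∣-∣≤ x≤y (orc x y x≤y))) ,
           λ x y x≤y → proj₁ (orc x y x≤y))
  (λ (c , or) x y x≤y → ∣-∣≤⇒within (or x y x≤y) x≤y (∣-∣≤-swapˡ (toℕ (α x)) (toℕ (α y)) (c x y)))

wPlus⇔max : ∀ {n} {α : Transformation n} t → WPlusIs α (suc t) ⇔ MaxIs t α
wPlus⇔max {α = α} t = mk⇔
  (λ ((x , e) , bound) → (x , suc-injective (trans (sym (+-comm (toℕ (α x)) 1)) e)) ,
                         λ y → ≤-pred (subst (_≤ suc t) (+-comm (toℕ (α y)) 1) (bound y)))
  (λ ((x , e) , bound) → (x , trans (+-comm (toℕ (α x)) 1) (cong suc e)) ,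
                         λ y → subst (_≤ suc t) (sym (+-comm (toℕ (α y)) 1)) (s≤s (bound y)))

opc-◂ : ∀ {m n} {b : Fin n} {f : Fin (suc m) → Fin n} →
        OPContraction (b ◂ f) ⇔ (OPContraction f × Within (toℕ b) (toℕ (f zero)) 1)
opc-◂ {b = b} {f} = mk⇔
  (λ opc → (λ x y x≤y → opc (suc x) (suc y) (s≤s x≤y)) , opc zero (suc zero) z≤n)
  (λ (opc , step) → extend opc step)
  where
    extend : OPContraction f → Within (toℕ b) (toℕ (f zero)) 1 → OPContraction (b ◂ f)
    extend opc step zero    zero    _         = within-refl (toℕ b)
    extend opc step zero    (suc y) _         =
      subst (Within (toℕ b) (toℕ (f y))) (+-comm (toℕ y) 1) (within-trans step (opc zero y z≤n))
    extend opc step (suc x) (suc y) (s≤s x≤y) = opc x y x≤y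

orc-◂ : ∀ {m n} {b : Fin n} {f : Fin (suc m) → Fin n} →
        ORContraction (b ◂ f) ⇔ (ORContraction f × Within (toℕ (f zero)) (toℕ b) 1)
orc-◂ {b = b} {f} = mk⇔
  (λ orc → (λ x y x≤y → orc (suc x) (suc y) (s≤s x≤y)) , orc zero (suc zero) z≤n)
  (λ (orc , step) → extend orc step)
  where
    extend : ORContraction f → Within (toℕ (f zero)) (toℕ b) 1 → ORContraction (b ◂ f)
    extend orc step zero    zero    _         = within-refl (toℕ b)
    extend orc step zero    (suc y) _         = within-trans (orc zero y z≤n) step
    extend orc step (suc x) (suc y) (s≤s x≤y) = orc x y x≤y

opc-single : ∀ {n} (g : Fin 1 → Fin n) → OPContraction g
opc-single g zero zero _ = within-refl (toℕ (g zero))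

orc-single : ∀ {n} (g : Fin 1 → Fin n) → ORContraction g
orc-single g zero zero _ = within-refl (toℕ (g zero))

orc-head-max : ∀ {m n} {g : Fin (suc m) → Fin n} → ORContraction g → ∀ x → toℕ (g x) ≤ toℕ (g zero)
orc-head-max orc x = proj₁ (orc zero x z≤n)

single-head-max : ∀ {n} (g : Fin 1 → Fin n) → ∀ x → toℕ (g x) ≤ toℕ (g zero)
single-head-max g zero = ≤-refl

max-at-head : ∀ {m n} {g : Fin (suc m) → Fin n} t → (∀ x → toℕ (g x) ≤ toℕ (g zero)) →
              MaxIs t g ⇔ HeadIs t g
max-at-head {g = g} t headMax = mk⇔
  (λ ((x , gx≡t) , bound) → ≤-antisym (bound zero) (subst (_≤ toℕ (g zero)) gx≡t (headMax x)))
  (λ g₀≡t → (zero , g₀≡t) , λ x → subst (toℕ (g x) ≤_) g₀≡t (headMax x))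

max-◂ : ∀ {m n} {b : Fin n} {f : Fin (suc m) → Fin n} t →
        toℕ b ≤ toℕ (f zero) → MaxIs t (b ◂ f) ⇔ MaxIs t f
max-◂ {b = b} {f} t b≤f₀ = mk⇔
  (λ { ((zero , b≡t) , bound) → (zero , ≤-antisym (bound (suc zero)) (subst (_≤ toℕ (f zero)) b≡t b≤f₀)) ,
                                 λ x → bound (suc x)
     ; ((suc x , fx≡t) , bound) → (x , fx≡t) , λ y → bound (suc y) })
  (λ ((x , fx≡t) , bound) → (suc x , fx≡t) , λ { zero → ≤-trans b≤f₀ (bound zero) ; (suc y) → bound y })

Respects≗ : ∀ {m n} → Pred (Fin m → Fin n) 0ℓ → Set
Respects≗ P = ∀ {g h} → g ≗ h → P g → P h

opc-resp : ∀ {m n} → Respects≗ (OPContraction {m} {n})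
opc-resp g≗h opc x y x≤y = subst₂ (λ u v → Within (toℕ u) (toℕ v) _) (g≗h x) (g≗h y) (opc x y x≤y)

orc-resp : ∀ {m n} → Respects≗ (ORContraction {m} {n})
orc-resp g≗h orc x y x≤y = subst₂ (λ u v → Within (toℕ v) (toℕ u) _) (g≗h x) (g≗h y) (orc x y x≤y)

head-resp : ∀ {m n} a → Respects≗ (HeadIs {m} {n} a)
head-resp a g≗h g₀≡a = trans (cong toℕ (sym (g≗h zero))) g₀≡a

max-resp : ∀ {m n} t → Respects≗ (MaxIs {m} {n} t)
max-resp t g≗h ((x , gx≡t) , bound) =
  (x , trans (cong toℕ (sym (g≗h x))) gx≡t) , λ y → subst (λ v → toℕ v ≤ t) (g≗h y) (bound y)

∩-resp : ∀ {m n} {P Q : Pred (Fin m → Fin n) 0ℓ} → Respects≗ P → Respects≗ Q → Respects≗ (P ∩ Q)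
∩-resp P-resp Q-resp g≗h (p , q) = P-resp g≗h p , Q-resp g≗h q

module Enumeration (n : ℕ) where

  Seq : ℕ → Set
  Seq m = Fin m → Fin n

  seqs : (m : ℕ) → List (Seq m)
  seqs = allFunctions (allFin n)

  count-seqs-suc : ∀ m {P : Pred (Seq (suc m)) 0ℓ} (P? : Decidable P) → Respects≗ P →
                   count P? (seqs (suc m)) ≡ ∑[ b < n ] count (λ f → P? (b ◂ f)) (seqs m)
  count-seqs-suc m P? resp =
    trans (count-concat P? _ n (λ b → b))
          (sum-cong-≗ {n} λ b → trans (count-map P? _ (seqs m))
                                      (count-≐ _ (λ f → P? (b ◂ f)) (resp (prepend refl λ _ → refl) ,
                                                                       resp (prepend refl λ _ → refl))
                                                                      (seqs m)))
    where
      -- the enumeration prepends with its own function, which agrees pointwise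
      -- with _◂_ since both have the same value at zero and at every suc i
      prepend : ∀ {g h : Seq (suc m)} → g zero ≡ h zero → (∀ i → g (suc i) ≡ h (suc i)) → g ≗ h
      prepend e₀ eₛ zero    = e₀
      prepend e₀ eₛ (suc i) = eₛ i

  count-by-head : ∀ {m} a → a < n →
                  {P : Pred (Seq (suc m)) 0ℓ} (P? : Decidable P) → Respects≗ P →
                  {Q : Pred (Seq m) 0ℓ} (Q? : Decidable Q) →
                  (∀ {b f} → P (b ◂ f) → toℕ b ≡ a) →
                  (∀ {b f} → toℕ b ≡ a → P (b ◂ f) ⇔ Q f) →
                  count P? (seqs (suc m)) ≡ count Q? (seqs m)
  count-by-head {m} a a<n P? resp Q? forced reduce =
    trans (count-seqs-suc m P? resp)
          (∑-single _ a a<n (λ b b≢a → count-∅ _ (λ f p → b≢a (forced p)) (seqs m))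
                    _ (λ b b≡a → count-≐ _ Q? (to (reduce b≡a) , from (reduce b≡a)) (seqs m)))

  UpFrom : ∀ {m} → ℕ → ℕ → Pred (Seq (suc m)) 0ℓ
  UpFrom a t = OPContraction ∩ HeadIs a ∩ MaxIs t

  upFrom? : ∀ {m} a t → Decidable (UpFrom {m} a t)
  upFrom? a t = opc? ∩? head? a ∩? max? t

  upFrom-resp : ∀ {m} a t → Respects≗ (UpFrom {m} a t)
  upFrom-resp a t = ∩-resp opc-resp (∩-resp (head-resp a) (max-resp t))

  up : ℕ → ℕ → ℕ → ℕ
  up m a t = count (upFrom? {m} a t) (seqs (suc m))

  upFrom-◂ : ∀ {m a t} {b : Fin n} {f : Seq (suc m)} → toℕ b ≡ a →
             UpFrom a t (b ◂ f) ⇔ (UpFrom a t f ⊎ UpFrom (suc a) t f)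
  upFrom-◂ {t = t} {b} {f} refl = mk⇔ forward backward
    where
      forward : UpFrom (toℕ b) t (b ◂ f) → UpFrom (toℕ b) t f ⊎ UpFrom (suc (toℕ b)) t f
      forward (opc , _ , mx) with to (opc-◂ {b = b} {f}) opc
      ... | opcf , step with to within-one step
      ...   | inj₁ f₀≡b  = inj₁ (opcf , f₀≡b , to (max-◂ t (proj₁ step)) mx)
      ...   | inj₂ f₀≡1+b = inj₂ (opcf , f₀≡1+b , to (max-◂ t (proj₁ step)) mx)
      extend : OPContraction f → (toℕ (f zero) ≡ toℕ b ⊎ toℕ (f zero) ≡ suc (toℕ b)) → MaxIs t f →
               UpFrom (toℕ b) t (b ◂ f)
      extend opcf next mx =
        let step = from within-one next
        in from opc-◂ (opcf , step) , refl , from (max-◂ t (proj₁ step)) mx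
      backward : UpFrom (toℕ b) t f ⊎ UpFrom (suc (toℕ b)) t f → UpFrom (toℕ b) t (b ◂ f)
      backward (inj₁ (opcf , f₀≡b , mx))   = extend opcf (inj₁ f₀≡b) mx
      backward (inj₂ (opcf , f₀≡1+b , mx)) = extend opcf (inj₂ f₀≡1+b) mx

  up-vanish : ∀ m a t → t < a → up m a t ≡ 0
  up-vanish m a t t<a =
    count-∅ _ (λ g (_ , g₀≡a , _ , bound) → <⇒≱ t<a (subst (_≤ t) g₀≡a (bound zero))) (seqs (suc m))

  up-base : ∀ a t → a ≤ t → a < n → up 0 a t ≡ 0 C (t ∸ a)
  up-base a t a≤t a<n =
    trans (count-by-head a a<n (upFrom? a t) (upFrom-resp a t) {Q = λ _ → a ≡ t} (λ _ → a ≟ t)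
                         (λ (_ , b≡a , _) → b≡a) reduce)
          single
    where
      reduce : ∀ {b f} → toℕ b ≡ a → UpFrom a t (b ◂ f) ⇔ a ≡ t
      reduce {b} {f} b≡a = mk⇔
        (λ (_ , _ , mx) → trans (sym b≡a) (to (max-at-head t (single-head-max (b ◂ f))) mx))
        (λ a≡t → opc-single (b ◂ f) , b≡a , from (max-at-head t (single-head-max (b ◂ f))) (trans b≡a a≡t))
      single : count {P = λ _ → a ≡ t} (λ _ → a ≟ t) (seqs 0) ≡ 0 C (t ∸ a)
      single with m≤n⇒m<n∨m≡n a≤t
      ... | inj₂ refl = trans (cong length (filter-accept (λ _ → a ≟ a) refl)) (cong (0 C_) (sym (n∸n≡0 a)))
      ... | inj₁ a<t  = trans (count-∅ {P = λ _ → a ≡ t} (λ _ → a ≟ t) (λ _ → <⇒≢ a<t) (seqs 0)) (sym (k>n⇒nCk≡0 (m<n⇒0<n∸m a<t)))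

  up-step : ∀ m a t → a < n → up (suc m) a t ≡ up m a t + up m (suc a) t
  up-step m a t a<n =
    trans (count-by-head a a<n (upFrom? a t) (upFrom-resp a t) (upFrom? a t ∪? upFrom? (suc a) t)
                         (λ (_ , b≡a , _) → b≡a) upFrom-◂)
          (count-disjoint-∪ (upFrom? a t) (upFrom? (suc a) t)
             (λ g ((_ , g₀≡a , _) , (_ , g₀≡1+a , _)) → 1+n≢n (trans (sym g₀≡1+a) g₀≡a)) (seqs (suc m)))

  -- Starting at a, the sequence must rise by t − a in m steps: C(m, t − a) ways.
  up-closed : ∀ m a t → a ≤ t → t < n → up m a t ≡ m C (t ∸ a)
  up-closed zero    a t a≤t t<n = up-base a t a≤t (≤-<-trans a≤t t<n)
  up-closed (suc m) a t a≤t t<n with m≤n⇒m<n∨m≡n a≤t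
  ... | inj₂ refl = begin
    up (suc m) a a               ≡⟨ up-step m a a t<n ⟩
    up m a a + up m (suc a) a    ≡⟨ cong₂ _+_ (up-closed m a a ≤-refl t<n) (up-vanish m (suc a) a (n<1+n a)) ⟩
    m C (a ∸ a) + 0              ≡⟨ +-identityʳ _ ⟩
    m C (a ∸ a)                  ≡⟨ cong (m C_) (n∸n≡0 a) ⟩
    m C 0                        ≡⟨⟩
    suc m C 0                    ≡⟨ cong (suc m C_) (sym (n∸n≡0 a)) ⟩
    suc m C (a ∸ a)              ∎
    where open ≡-Reasoning
  ... | inj₁ a<t = begin
    up (suc m) a t                ≡⟨ up-step m a t (≤-<-trans a≤t t<n) ⟩
    up m a t + up m (suc a) t     ≡⟨ cong₂ _+_ (up-closed m a t a≤t t<n) (up-closed m (suc a) t a<t t<n) ⟩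
    m C (t ∸ a) + m C j           ≡⟨ cong (λ i → m C i + m C j) t∸a≡1+j ⟩
    m C suc j + m C j             ≡⟨ +-comm (m C suc j) (m C j) ⟩
    m C j + m C suc j             ≡⟨ nCk+nC[k+1]≡[n+1]C[k+1] m j ⟩
    suc m C suc j                 ≡⟨ cong (suc m C_) (sym t∸a≡1+j) ⟩
    suc m C (t ∸ a)               ∎
    where
      open ≡-Reasoning
      j : ℕ
      j = t ∸ suc a
      t∸a≡1+j : t ∸ a ≡ suc j
      t∸a≡1+j = +-∸-assoc 1 a<t

  DownFrom : ∀ {m} → ℕ → Pred (Seq (suc m)) 0ℓ
  DownFrom a = ORContraction ∩ HeadIs a

  downFrom? : ∀ {m} a → Decidable (DownFrom {m} a)
  downFrom? a = orc? ∩? head? a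

  downFrom-resp : ∀ {m} a → Respects≗ (DownFrom {m} a)
  downFrom-resp a = ∩-resp orc-resp (head-resp a)

  down : ℕ → ℕ → ℕ
  down m a = count (downFrom? {m} a) (seqs (suc m))

  downFrom-◂ : ∀ {m a} {b : Fin n} {f : Seq (suc m)} → toℕ b ≡ a →
               DownFrom a (b ◂ f) ⇔ (ORContraction f × (a ≡ toℕ (f zero) ⊎ a ≡ suc (toℕ (f zero))))
  downFrom-◂ {b = b} {f} refl = mk⇔
    (λ (orc , _) → let (orcf , step) = to (orc-◂ {b = b} {f}) orc in orcf , to within-one step)
    (λ (orcf , next) → from orc-◂ (orcf , from within-one next) , refl)

  down-base : ∀ a → a < n → down 0 a ≡ 1
  down-base a a<n = count-by-head a a<n (downFrom? a) (downFrom-resp a) U? proj₂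
    (λ b≡a → mk⇔ (λ _ → tt) (λ _ → orc-single _ , b≡a))

  down-step-zero : ∀ m → 0 < n → down (suc m) 0 ≡ down m 0
  down-step-zero m 0<n = count-by-head 0 0<n (downFrom? 0) (downFrom-resp 0) (downFrom? 0) proj₂ reduce
    where
      reduce : ∀ {b f} → toℕ b ≡ 0 → DownFrom 0 (b ◂ f) ⇔ DownFrom 0 f
      reduce b≡0 = mk⇔
        (λ d → case-next (to (downFrom-◂ b≡0) d))
        (λ (orcf , f₀≡0) → from (downFrom-◂ b≡0) (orcf , inj₁ (sym f₀≡0)))
        where
          case-next : ∀ {f : Seq (suc m)} → ORContraction f × (0 ≡ toℕ (f zero) ⊎ 0 ≡ suc (toℕ (f zero))) → DownFrom 0 f
          case-next (orcf , inj₁ 0≡f₀) = orcf , sym 0≡f₀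
          case-next (_    , inj₂ ())

  down-step-suc : ∀ m a → suc a < n → down (suc m) (suc a) ≡ down m (suc a) + down m a
  down-step-suc m a a<n =
    trans (count-by-head (suc a) a<n (downFrom? (suc a)) (downFrom-resp (suc a))
                         (downFrom? (suc a) ∪? downFrom? a) proj₂ reduce)
          (count-disjoint-∪ (downFrom? (suc a)) (downFrom? a)
             (λ g ((_ , g₀≡1+a) , (_ , g₀≡a)) → 1+n≢n (trans (sym g₀≡1+a) g₀≡a)) (seqs (suc m)))
    where
      reduce : ∀ {b f} → toℕ b ≡ suc a → DownFrom (suc a) (b ◂ f) ⇔ (DownFrom (suc a) f ⊎ DownFrom a f)
      reduce b≡1+a = mk⇔
        (λ d → case-next (to (downFrom-◂ b≡1+a) d))
        (λ { (inj₁ (orcf , f₀≡1+a)) → from (downFrom-◂ b≡1+a) (orcf , inj₁ (sym f₀≡1+a))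
           ; (inj₂ (orcf , f₀≡a))   → from (downFrom-◂ b≡1+a) (orcf , inj₂ (cong suc (sym f₀≡a))) })
        where
          case-next : ∀ {f : Seq (suc m)} → ORContraction f × (suc a ≡ toℕ (f zero) ⊎ suc a ≡ suc (toℕ (f zero))) →
                      DownFrom (suc a) f ⊎ DownFrom a f
          case-next (orcf , inj₁ 1+a≡f₀) = inj₁ (orcf , sym 1+a≡f₀)
          case-next (orcf , inj₂ 1+a≡1+f₀) = inj₂ (orcf , sym (suc-injective 1+a≡1+f₀))

  -- Descending from a by at most one per step in m steps: Σ_{j≤a} C(m, j) ways.
  down-closed : ∀ m a → a < n → down m a ≡ binomSum m a
  down-closed zero    a       a<n = trans (down-base a a<n) (sym (binomSum-zero a))
  down-closed (suc m) zero    0<n = trans (down-step-zero m 0<n) (down-closed m zero 0<n)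
  down-closed (suc m) (suc a) a<n = begin
    down (suc m) (suc a)              ≡⟨ down-step-suc m a a<n ⟩
    down m (suc a) + down m a         ≡⟨ cong₂ _+_ (down-closed m (suc a) a<n) (down-closed m a (<-trans (n<1+n a) a<n)) ⟩
    binomSum m (suc a) + binomSum m a ≡⟨ sym (binomSum-pascal m a) ⟩
    binomSum (suc m) (suc a)          ∎
    where open ≡-Reasoning

  Flat : ∀ {m} → ℕ → Pred (Seq (suc m)) 0ℓ
  Flat a = OPContraction ∩ ORContraction ∩ HeadIs a

  flat? : ∀ {m} a → Decidable (Flat {m} a)
  flat? a = opc? ∩? orc? ∩? head? a

  flat : ℕ → ℕ → ℕ
  flat m a = count (flat? {m} a) (seqs (suc m))

  flat-resp : ∀ {m} a → Respects≗ (Flat {m} a)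
  flat-resp a = ∩-resp opc-resp (∩-resp orc-resp (head-resp a))

  -- Such a map is constant, so there is exactly one.
  flat-closed : ∀ m a → a < n → flat m a ≡ 1
  flat-closed zero    a a<n = count-by-head a a<n (flat? a) (flat-resp a) U? (λ (_ , _ , b≡a) → b≡a)
    (λ b≡a → mk⇔ (λ _ → tt) (λ _ → opc-single _ , orc-single _ , b≡a))
  flat-closed (suc m) a a<n =
    trans (count-by-head a a<n (flat? a) (flat-resp a) (flat? a) (λ (_ , _ , b≡a) → b≡a) reduce)
          (flat-closed m a a<n)
    where
      reduce : ∀ {b f} → toℕ b ≡ a → Flat a (b ◂ f) ⇔ Flat a f
      reduce {b} {f} b≡a = mk⇔
        (λ (opc , orc , _) →
           let (opcf , rise) = to (opc-◂ {b = b} {f}) opc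
               (orcf , fall) = to (orc-◂ {b = b} {f}) orc
           in opcf , orcf , trans (≤-antisym (proj₁ fall) (proj₁ rise)) b≡a)
        (λ (opcf , orcf , f₀≡a) →
           let f₀≡b = trans f₀≡a (sym b≡a)
           in from opc-◂ (opcf , from within-one (inj₁ f₀≡b)) ,
              from orc-◂ (orcf , from within-one (inj₁ (sym f₀≡b))) , b≡a)

  OPCMax ORCMax : ∀ {m} → ℕ → Pred (Seq m) 0ℓ
  OPCMax t = OPContraction ∩ MaxIs t
  ORCMax t = ORContraction ∩ MaxIs t

  opcMax? : ∀ {m} t → Decidable (OPCMax {m} t)
  opcMax? t = opc? ∩? max? t

  orcMax? : ∀ {m} t → Decidable (ORCMax {m} t)
  orcMax? t = orc? ∩? max? t

  up-by-head : ∀ M t (b : Fin n) → up M (toℕ b) t ≡ count (λ f → opcMax? t (b ◂ f)) (seqs M)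
  up-by-head M t b = count-by-head (toℕ b) (toℕ<n b) (upFrom? (toℕ b) t) (upFrom-resp (toℕ b) t)
    (λ f → opcMax? t (b ◂ f)) (λ (_ , b≡a , _) → b≡a) reduce
    where
      reduce : ∀ {b′ f} → toℕ b′ ≡ toℕ b → UpFrom (toℕ b) t (b′ ◂ f) ⇔ OPCMax t (b ◂ f)
      reduce b′≡b rewrite toℕ-injective b′≡b = mk⇔ (λ (opc , _ , mx) → opc , mx) (λ (opc , mx) → opc , refl , mx)

  count-opcMax : ∀ M t → t < n → count (opcMax? t) (seqs (suc M)) ≡ binomSum M t
  count-opcMax M t t<n = begin
    count (opcMax? t) (seqs (suc M))
      ≡⟨ count-seqs-suc M (opcMax? t) (∩-resp opc-resp (max-resp t)) ⟩
    ∑[ b < n ] count (λ f → opcMax? t (b ◂ f)) (seqs M)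
      ≡⟨ sum-cong-≗ {n} (λ b → sym (up-by-head M t b)) ⟩
    ∑[ b < n ] up M (toℕ b) t
      ≡⟨ ∑-truncate (λ a → up M a t) t<n (λ a t<a → up-vanish M a t t<a) ⟩
    ∑[ b < suc t ] up M (toℕ b) t
      ≡⟨ sum-cong-≗ {suc t} (λ b → up-closed M (toℕ b) t (≤-pred (toℕ<n b)) t<n) ⟩
    ∑[ b < suc t ] (M C (t ∸ toℕ b))
      ≡⟨ binomSum-reversed M t ⟩
    binomSum M t ∎
    where open ≡-Reasoning

  -- An ORC peaks at its first value, so these are counted by down.
  count-orcMax : ∀ M t → t < n → count (orcMax? t) (seqs (suc M)) ≡ binomSum M t
  count-orcMax M t t<n = trans
    (count-≐ (orcMax? t) (downFrom? t)
      ((λ (orc , mx) → orc , to (max-at-head t (orc-head-max orc)) mx) ,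
       (λ (orc , h) → orc , from (max-at-head t (orc-head-max orc)) h))
      (seqs (suc M)))
    (down-closed M t t<n)

  count-bothMax : ∀ M t → t < n → count (opcMax? t ∩? orcMax? t) (seqs (suc M)) ≡ 1
  count-bothMax M t t<n = trans
    (count-≐ (opcMax? t ∩? orcMax? t) (flat? t)
      ((λ ((opc , mx) , (orc , _)) → opc , orc , to (max-at-head t (orc-head-max orc)) mx) ,
       (λ (opc , orc , h) → let mx = from (max-at-head t (orc-head-max orc)) h in (opc , mx) , (orc , mx)))
      (seqs (suc M)))
    (flat-closed M t t<n)

orct≐ : ∀ {n} t → (IsORCT ∩ (λ α → WPlusIs α (suc t))) ≐ (OPContraction ∩ MaxIs t ∪ ORContraction ∩ MaxIs {n} t)
orct≐ t =
  (λ { ((c , inj₁ op) , w) → inj₁ (from opc⇔ (c , op) , to (wPlus⇔max t) w)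
     ; ((c , inj₂ or) , w) → inj₂ (from orc⇔ (c , or) , to (wPlus⇔max t) w) }) ,
  (λ { (inj₁ (opc , mx)) → let (c , op) = to opc⇔ opc in (c , inj₁ op) , from (wPlus⇔max t) mx
     ; (inj₂ (orc , mx)) → let (c , or) = to orc⇔ orc in (c , inj₂ or) , from (wPlus⇔max t) mx })

X+1≡s+s⇒X≡2s∸1 : ∀ X s → X + 1 ≡ s + s → X ≡ 2 * s ∸ 1
X+1≡s+s⇒X≡2s∸1 X s e = begin
  X          ≡⟨ sym (m+n∸n≡m X 1) ⟩
  X + 1 ∸ 1  ≡⟨ cong (_∸ 1) e ⟩
  s + s ∸ 1  ≡⟨ cong (λ z → s + z ∸ 1) (sym (+-identityʳ s)) ⟩
  2 * s ∸ 1  ∎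
  where open ≡-Reasoning

-- With n = M+1 and k = t+1, inclusion–exclusion over the OPC and ORC maps:
-- count + 1 = binomSum M t + binomSum M t.
corollary3p5 : (n k : ℕ) → 1 ≤ n → 1 ≤ k → k ≤ n →
    countORCTw n k ≡ 2 * sumFrom1 k (λ p → (n ∸ 1) C (p ∸ 1)) ∸ 1
corollary3p5 (suc M) (suc t) _ _ (s≤s t≤M) = X+1≡s+s⇒X≡2s∸1 _ (binomSum M t) (begin
  countORCTw (suc M) (suc t) + 1
    ≡⟨ cong₂ _+_ (count-≐ _ (opcMax? t ∪? orcMax? t) (orct≐ t) maps) (sym (count-bothMax M t t<n)) ⟩
  count (opcMax? t ∪? orcMax? t) maps + count (opcMax? t ∩? orcMax? t) maps
    ≡⟨ count-∪ (opcMax? t) (orcMax? t) maps ⟩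
  count (opcMax? t) maps + count (orcMax? t) maps
    ≡⟨ cong₂ _+_ (count-opcMax M t t<n) (count-orcMax M t t<n) ⟩
  binomSum M t + binomSum M t ∎)
  where
    open Enumeration (suc M)
    open ≡-Reasoning
    maps : List (Seq (suc M))
    maps = seqs (suc M)
    t<n : t < suc M
    t<n = s≤s t≤M
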